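{- Let $G=(A\uplus B,E)$ be a bipartite graph, $v$ a vertex of $G$ of degree $d$, and $G'=G-v$ the graph obtained by deleting $v$ (and its incident edges), with sides $A\setminus\{v\}$, $B\setminus\{v\}$. Let $k,l$ be positive integers. (1) If $G'$ is $(k,l)$-stress free and $d\le l$ when $v\in A$ (respectively $d\le k$ when $v\in B$), then $G$ is $(k,l)$-stress free. (2) If $G'$ is $(k,l)$-rigid and $d\ge l$ when $v\in A$ (respectively $d\ge k$ when $v\in B$), then $G$ is $(k,l)$-rigid.
   Context: All graphs are finite and simple. A bipartite graph $G=(A\uplus B,E)$ has a fixed bipartition; identify $A=\{1<\dots<n\}$, $B=\{1'<\dots<m'\}$ and write $ij'$ for the pair $\{i,j'\}$. Let $S=\mathbb{R}[x_1,\dots,x_n,y_1,\dots,y_m]$, $I_G$ the ideal generated by all $x_ix_j$ ($i<j$), all $y_iy_j$ ($i<j$) and all $x_iy_j$ with $ij'\notin E$, and $\mathbb{R}[G]=S/I_G$, $\mathbb{Z}^2$-graded by $\deg x_i=(1,0)$, $\deg y_j=(0,1)$. Fix generic reals (e.g. algebraically independent over $\mathbb{Q}$) $\theta_{ij}$ ($1\le i,j\le n$), $\theta_{s't'}$ ($1\le s,t\le m$) and put $\theta_i=\sum_j\theta_{ij}x_j$, $\theta_{s'}=\sum_t\theta_{s't'}y_t$. For a total order $<$ on $A\uplus B$ extending the natural orders on $A$ and $B$, with induced lexicographic order $<_{\mathrm{lex}}$ on pairs $ij'$, the balanced shifting $G^{b,<}$ is the bipartite graph on $A\uplus B$ whose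 edges are the $ij'$ with $\theta_i\theta_{j'}\notin\operatorname{span}\{\theta_p\theta_{q'}:pq'<_{\mathrm{lex}}ij'\}\subseteq\mathbb{R}[G]_{(1,1)}$. The order is $(k,l)$-admissible if $\{1,\dots,k\}\cup\{1',\dots,l'\}$ is an initial segment of it. $G$ is $(k,l)$-stress free if $(k+1)(l+1)'$ is not an edge of $G^{b,<}$, and $(k,l)$-rigid if every $ij'$ with $i\le k$ or $j\le l$ is an edge of $G^{b,<}$, for a $(k,l)$-admissible order $<$ (this does not depend on the choice of such order). Equivalently, with the $|E|\times(l|A|+k|B|)$ matrix $R^{(k,l)}(G)$ whose row for edge $ab'$ has entries $(\theta_{i'b'})_{i\le l}$ in the $l$ columns of $a$, $(\theta_{ia})_{i\le k}$ in the $k$ columns of $b'$, and $0$ elsewhere: $G$ is $(k,l)$-stress free iff the rows are independent, and $(k,l)$-rigid iff the rank is $l|A|+k|B|-kl$. -}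

module Defs where

open import Data.Nat using (ℕ; zero; suc; _+_; _*_; _≤_)
open import Data.Integer using (ℤ; 0ℤ) renaming (_+_ to _+ℤ_; _*_ to _*ℤ_)
open import Data.Fin using (Fin; zero; suc; punchIn; _≟_)
open import Data.Bool using (Bool; true; false; if_then_else_)
open import Data.Product using (Σ; _×_; _,_)
open import Data.Sum using (_⊎_; inj₁; inj₂)
open import Relation.Nullary using (¬_)
open import Relation.Nullary.Decidable using (⌊_⌋)
open import Relation.Binary.PropositionalEquality using (_≡_)
open import Function.Definitions using (Injective)

-- A finite simple bipartite graph with sides A = Fin n, B = Fin m,
-- given by its bipartite adjacency relation (edge ij' iff G i j ≡ true).
BGraph : ℕ → ℕ → Set
BGraph n m = Fin n → Fin m → Bool

deleteA : ∀ {n m} → BGraph (suc n) m → Fin (suc n) → BGraph n m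
deleteA G v i j = G (punchIn v i) j

deleteB : ∀ {n m} → BGraph n (suc m) → Fin (suc m) → BGraph n m
deleteB G v i j = G i (punchIn v j)

count : ∀ {m} → (Fin m → Bool) → ℕ
count {zero} f = zero
count {suc m} f = (if f zero then 1 else 0) + count (λ j → f (suc j))

degA : ∀ {n m} → BGraph n m → Fin n → ℕ
degA G v = count (λ j → G v j)

degB : ∀ {n m} → BGraph n m → Fin m → ℕ
degB G v = count (λ i → G i v)

sumℤ : ∀ {r} → (Fin r → ℤ) → ℤ
sumℤ {zero} f = 0ℤ
sumℤ {suc r} f = f zero +ℤ sumℤ (λ t → f (suc t))

-- Columns of R^(k,l)(G): l columns for each a ∈ A, k columns for each b' ∈ B.
Col : ℕ → ℕ → ℕ → ℕ → Set
Col k l n m = (Fin n × Fin l) ⊎ (Fin m × Fin k)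

-- Entry of R^(k,l)(G) in the row of the pair ab' and a given column,
-- for a specialisation θA q a = θ_{q a} (q ≤ k), θB p b = θ_{p' b'} (p ≤ l).
entry : ∀ {k l n m} → (Fin k → Fin n → ℤ) → (Fin l → Fin m → ℤ)
      → Fin n × Fin m → Col k l n m → ℤ
entry θA θB (a , b) (inj₁ (a' , p)) = if ⌊ a ≟ a' ⌋ then θB p b else 0ℤ
entry θA θB (a , b) (inj₂ (b' , q)) = if ⌊ b ≟ b' ⌋ then θA q a else 0ℤ

RowsIndependent : ∀ k l {n m} → BGraph n m
                → (Fin k → Fin n → ℤ) → (Fin l → Fin m → ℤ) → Set
RowsIndependent k l {n} {m} G θA θB =
  (c : Fin n → Fin m → ℤ) →
  (∀ a b → G a b ≡ false → c a b ≡ 0ℤ) →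
  (∀ (col : Col k l n m) →
     sumℤ (λ a → sumℤ (λ b → c a b *ℤ entry θA θB (a , b) col)) ≡ 0ℤ) →
  ∀ a b → c a b ≡ 0ℤ

-- Generic independence: the rows are independent for generic θ, which is
-- equivalent to independence for some integer specialisation of θ.
StressFree : ∀ (k l : ℕ) {n m} → BGraph n m → Set
StressFree k l {n} {m} G =
  Σ (Fin k → Fin n → ℤ) λ θA → Σ (Fin l → Fin m → ℤ) λ θB →
    RowsIndependent k l G θA θB

-- generic rank of R^(k,l)(G) is ≥ r: some specialisation has r independent
-- (distinct) edge rows.
RankAtLeast : ∀ (k l : ℕ) {n m} → BGraph n m → ℕ → Set
RankAtLeast k l {n} {m} G r =
  Σ (Fin k → Fin n → ℤ) λ θA → Σ (Fin l → Fin m → ℤ) λ θB →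
  Σ (Fin r → Fin n × Fin m) λ f →
    Injective _≡_ _≡_ f ×
    (∀ t → G (Data.Product.proj₁ (f t)) (Data.Product.proj₂ (f t)) ≡ true) ×
    ((c : Fin r → ℤ) →
      (∀ (col : Col k l n m) →
         sumℤ (λ t → c t *ℤ entry θA θB (f t) col) ≡ 0ℤ) →
      ∀ t → c t ≡ 0ℤ)

Rigid : ∀ (k l : ℕ) {n m} → BGraph n m → Set
Rigid k l {n} {m} G =
  Σ ℕ λ r → (r + k * l ≡ l * n + k * m) ×
    RankAtLeast k l G r × ¬ RankAtLeast k l G (suc r)

{-# OPTIONS --safe #-}
-- All ranks are computed at integer specialisations of θ. Put θ_{q v} = 0 for the new vertex v ∈ A:
-- then the old rows vanish on the l columns of v, and the rows of the edges at v vanish outside them,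
-- where they are the vectors (θ_{p' b'})_p of the neighbours b' of v. So all these rows are independent
-- as soon as the old rows and those vectors are, which can be arranged when deg v ≤ l (for (1)), resp.
-- for l of the neighbours (for the lower bound in (2)). To do so without losing the independence of
-- the old rows, θ_{p' b'} is moved along a segment towards a specialisation with unit vectors there:
-- all entries are polynomial in the parameter, and a polynomial family that is independent at one
-- point is independent at all large points. The upper bound rank ≤ l|A| + k|B| − kl in (2) holds for
-- every graph with |B| ≥ l: the kl trivial motions are orthogonal to all rows and, at a specialisation
-- reached in the same way, independent; over ℤ orthogonal independent families have at most as many
-- members together as there are columns. The case v ∈ B follows by transposing G.
module Submission where

open import Defs
open import Data.Nat as ℕ using (ℕ; zero; suc; _≤_; _<_; z≤n; s≤s; _⊔_)
import Data.Nat.Properties as ℕP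
import Data.Nat.Tactic.RingSolver as NatSolver
open import Data.Integer as ℤ using (ℤ; 0ℤ; 1ℤ; -1ℤ; -_; _+_; _*_; _-_; ∣_∣)
import Data.Integer.Properties as ℤP
open import Data.Integer.Tactic.RingSolver using (solve-∀)
open import Data.Fin as Fin
  using (Fin; zero; suc; punchIn; punchOut; _↑ˡ_; _↑ʳ_; splitAt; combine; remQuot; toℕ; fromℕ<)
import Data.Fin.Properties as FinP
open import Data.Vec.Functional using (removeAt; insertAt; _++_)
open import Data.Vec.Functional.Properties using (insertAt-lookup; insertAt-punchIn; lookup-++ˡ; lookup-++ʳ)
open import Data.List using (List; []; _∷_; map)
open import Data.List.Relation.Unary.Any as Any using (Any; here; there)
open import Data.List.Relation.Unary.All as All using (All; []; _∷_)
open import Data.List.Relation.Unary.All.Properties using (¬Any⇒All¬)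
open import Data.Bool using (Bool; true; false; if_then_else_)
open import Data.Product using (Σ; ∃; ∃-syntax; _×_; _,_; proj₁; proj₂; uncurry; swap)
open import Data.Sum as Sum using (inj₁; inj₂; [_,_]′; reduce)
open import Data.Empty using (⊥-elim)
open import Relation.Nullary using (¬_; yes; no; ¬?; Dec)
open import Relation.Nullary.Decidable using (⌊_⌋; isYes≗does; dec-true; dec-false; decidable-stable)
open import Function using (_∘_; id)
open import Function.Definitions using (Injective; StrictlySurjective)
open import Relation.Binary.PropositionalEquality
open import Algebra.Properties.Semiring.Sum ℤP.+-*-semiring
  using (sum; sum-cong-≗; ∑-distrib-+; ∑-comm; sum-remove; *-distribˡ-sum; sum-replicate-zero)

-- Finite sums

i≡0⇒i*j≡0 : ∀ {i} j → i ≡ 0ℤ → i * j ≡ 0ℤ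
i≡0⇒i*j≡0 j refl = ℤP.*-zeroˡ j

j≡0⇒i*j≡0 : ∀ i {j} → j ≡ 0ℤ → i * j ≡ 0ℤ
j≡0⇒i*j≡0 i refl = ℤP.*-zeroʳ i

sumℤ≡sum : ∀ {r} (f : Fin r → ℤ) → sumℤ f ≡ sum f
sumℤ≡sum {zero}  f = refl
sumℤ≡sum {suc r} f = cong (f zero +_) (sumℤ≡sum (f ∘ suc))

sumℤ²≡sum² : ∀ {n m} (h : Fin n → Fin m → ℤ) → sumℤ (λ a → sumℤ (h a)) ≡ sum (λ a → sum (h a))
sumℤ²≡sum² h = trans (sumℤ≡sum (λ a → sumℤ (h a))) (sum-cong-≗ (λ a → sumℤ≡sum (h a)))

sum-zero : ∀ {r} {f : Fin r → ℤ} → (∀ i → f i ≡ 0ℤ) → sum f ≡ 0ℤ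
sum-zero {r} f≡0 = trans (sum-cong-≗ f≡0) (sum-replicate-zero r)

sum-δ : ∀ {r} (f : Fin r → ℤ) i → (∀ j → j ≢ i → f j ≡ 0ℤ) → sum f ≡ f i
sum-δ {suc r} f i off≡0 = begin
  sum f                               ≡⟨ sum-remove {i = i} f ⟩
  f i + sum (λ j → f (punchIn i j))   ≡⟨ cong (f i +_) (sum-zero (λ j → off≡0 _ (FinP.punchInᵢ≢i i j))) ⟩
  f i + 0ℤ                            ≡⟨ ℤP.+-identityʳ (f i) ⟩
  f i                                 ∎
  where open ≡-Reasoning

sum-↑ : ∀ m {n} (f : Fin (m ℕ.+ n) → ℤ) → sum f ≡ sum (f ∘ (_↑ˡ n)) + sum (f ∘ (m ↑ʳ_))
sum-↑ zero    f = sym (ℤP.+-identityˡ (sum f))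
sum-↑ (suc m) f = trans (cong (f zero +_) (sum-↑ m (f ∘ suc))) (sym (ℤP.+-assoc (f zero) _ _))

sum-combine : ∀ n {k} (f : Fin (n ℕ.* k) → ℤ) →
  sum f ≡ sum (λ (a : Fin n) → sum (λ (b : Fin k) → f (combine a b)))
sum-combine zero        f = refl
sum-combine (suc n) {k} f =
  trans (sum-↑ k f) (cong (sum (λ b → f (b ↑ˡ (n ℕ.* k))) +_) (sum-combine n (f ∘ (k ↑ʳ_))))

sum-remQuot : ∀ n {k} (h : Fin n × Fin k → ℤ) → sum (h ∘ remQuot k) ≡ sum (λ a → sum (λ b → h (a , b)))
sum-remQuot n h = trans (sum-combine n (h ∘ remQuot _))
  (sum-cong-≗ (λ a → sum-cong-≗ (λ b → cong h (FinP.remQuot-combine a b))))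

sum-linear : ∀ {r} α β (f g : Fin r → ℤ) → sum (λ i → α * f i + β * g i) ≡ α * sum f + β * sum g
sum-linear α β f g = trans (∑-distrib-+ (λ i → α * f i) (λ i → β * g i))
  (sym (cong₂ _+_ (*-distribˡ-sum α f) (*-distribˡ-sum β g)))

sum-neg : ∀ {r} (f : Fin r → ℤ) → sum (λ i → - f i) ≡ - sum f
sum-neg f = begin
  sum (λ i → - f i)          ≡⟨ sum-cong-≗ (λ i → ℤP.-1*i≡-i (f i)) ⟨
  sum (λ i → -1ℤ * f i)      ≡⟨ *-distribˡ-sum -1ℤ f ⟨
  -1ℤ * sum f                ≡⟨ ℤP.-1*i≡-i (sum f) ⟩
  - sum f                    ∎
  where open ≡-Reasoning

square≡∣∣² : ∀ x → x * x ≡ ℤ.+ (∣ x ∣ ℕ.* ∣ x ∣)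
square≡∣∣² (ℤ.+ n)    = sym (ℤP.pos-* n n)
square≡∣∣² ℤ.-[1+ n ] = refl

sum-squares-nonNeg : ∀ {r} (f : Fin r → ℤ) → ∃[ N ] sum (λ i → f i * f i) ≡ ℤ.+ N
sum-squares-nonNeg {zero}  f = 0 , refl
sum-squares-nonNeg {suc r} f with sum-squares-nonNeg (f ∘ suc)
... | N , tail≡N = ∣ f zero ∣ ℕ.* ∣ f zero ∣ ℕ.+ N , cong₂ _+_ (square≡∣∣² (f zero)) tail≡N

sum-squares≡0⇒≡0 : ∀ {r} (f : Fin r → ℤ) → sum (λ i → f i * f i) ≡ 0ℤ → ∀ i → f i ≡ 0ℤ
sum-squares≡0⇒≡0 {suc r} f sum≡0 with sum-squares-nonNeg (f ∘ suc)
... | N , tail≡N = FinP.∀-cons head≡0 (sum-squares≡0⇒≡0 (f ∘ suc) tail≡0)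
  where
  total≡0 : ∣ f zero ∣ ℕ.* ∣ f zero ∣ ℕ.+ N ≡ 0
  total≡0 = ℤP.+-injective (trans (cong₂ _+_ (sym (square≡∣∣² (f zero))) (sym tail≡N)) sum≡0)
  head≡0 : f zero ≡ 0ℤ
  head≡0 = ℤP.∣i∣≡0⇒i≡0 (reduce (ℕP.m*n≡0⇒m≡0∨n≡0 ∣ f zero ∣ (ℕP.m+n≡0⇒m≡0 _ total≡0)))
  tail≡0 : sum (λ i → f (suc i) * f (suc i)) ≡ 0ℤ
  tail≡0 = trans tail≡N (cong ℤ.+_ (ℕP.m+n≡0⇒n≡0 _ total≡0))

-- Linear independence of integer vectors

true≢false : true ≢ false
true≢false ()

1≢0 : 1ℤ ≢ 0ℤ
1≢0 ()

i*j≡0⇒i≡0 : ∀ {i j} → j ≢ 0ℤ → i * j ≡ 0ℤ → i ≡ 0ℤ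
i*j≡0⇒i≡0 {i} j≢0 ij≡0 with ℤP.i*j≡0⇒i≡0∨j≡0 i ij≡0
... | inj₁ i≡0 = i≡0
... | inj₂ j≡0 = ⊥-elim (j≢0 j≡0)

x+y≡0⇒y≡-x : ∀ {x y} → x + y ≡ 0ℤ → y ≡ - x
x+y≡0⇒y≡-x {x} {y} x+y≡0 = trans (y≡x+y-x x y) (trans (cong (_- x) x+y≡0) (ℤP.+-identityˡ (- x)))
  where
  y≡x+y-x : ∀ x y → y ≡ (x + y) - x
  y≡x+y-x = solve-∀

∀-punchIn : ∀ {n} {P : Fin (suc n) → Set} i → P i → (∀ j → P (punchIn i j)) → ∀ j → P j
∀-punchIn {P = P} i Pi Pp j with i Fin.≟ j
... | yes refl = Pi
... | no i≢j   = subst P (FinP.punchIn-punchOut i≢j) (Pp (punchOut i≢j))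

∀-↑ : ∀ {m n} {P : Fin (m ℕ.+ n) → Set} → (∀ i → P (i ↑ˡ n)) → (∀ j → P (m ↑ʳ j)) → ∀ k → P k
∀-↑ {m} {n} {P} Pl Pr k = subst P (FinP.join-splitAt m n k) (P-join (splitAt m k))
  where
  P-join : ∀ i → P (Fin.join m n i)
  P-join (inj₁ i) = Pl i
  P-join (inj₂ j) = Pr j

module _ {A : Set} {s q : ℕ} where

  ∘-++ : ∀ {B : Set} (h : A → B) (u : Fin s → A) (w : Fin q → A) x → ((h ∘ u) ++ (h ∘ w)) x ≡ h ((u ++ w) x)
  ∘-++ h u w x with splitAt s x
  ... | inj₁ i = refl
  ... | inj₂ j = refl

  ++-∀ : ∀ {P : A → Set} {u : Fin s → A} {w : Fin q → A} →
    (∀ i → P (u i)) → (∀ j → P (w j)) → ∀ x → P ((u ++ w) x)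
  ++-∀ Pu Pw x with splitAt s x
  ... | inj₁ i = Pu i
  ... | inj₂ j = Pw j

  ++-injective : ∀ {u : Fin s → A} {w : Fin q → A} → Injective _≡_ _≡_ u → Injective _≡_ _≡_ w →
    (∀ i j → u i ≢ w j) → Injective _≡_ _≡_ (u ++ w)
  ++-injective {u} {w} u-inj w-inj u≢w {x} {y} eq = begin
    x                          ≡⟨ FinP.join-splitAt s q x ⟨
    Fin.join s q (splitAt s x) ≡⟨ cong (Fin.join s q) (split-injective (splitAt s x) (splitAt s y) eq) ⟩
    Fin.join s q (splitAt s y) ≡⟨ FinP.join-splitAt s q y ⟩
    y                          ∎
    where
    open ≡-Reasoning
    split-injective : ∀ a b → [ u , w ]′ a ≡ [ u , w ]′ b → a ≡ b
    split-injective (inj₁ i) (inj₁ i') e = cong inj₁ (u-inj e)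
    split-injective (inj₁ i) (inj₂ j)  e = ⊥-elim (u≢w i j e)
    split-injective (inj₂ j) (inj₁ i)  e = ⊥-elim (u≢w i j (sym e))
    split-injective (inj₂ j) (inj₂ j') e = cong inj₂ (w-inj e)

Family : ℕ → Set → Set
Family N X = Fin N → X → ℤ

combination : ∀ {N X} → (Fin N → ℤ) → Family N X → X → ℤ
combination c v x = sum (λ i → c i * v i x)

IndependentOn : ∀ {N X} → (Fin N → Bool) → Family N X → Set
IndependentOn {N} s v = (c : Fin N → ℤ) → (∀ i → s i ≡ false → c i ≡ 0ℤ) →
  (∀ x → combination c v x ≡ 0ℤ) → ∀ i → c i ≡ 0ℤ

Independent : ∀ {N X} → Family N X → Set
Independent = IndependentOn (λ _ → true)

module _ {N : ℕ} {X : Set} {s : Fin N → Bool} where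

  independentOn-cong : ∀ {v w : Family N X} → (∀ i x → v i x ≡ w i x) → IndependentOn s v → IndependentOn s w
  independentOn-cong v≡w indep c c-supp comb≡0 =
    indep c c-supp (λ x → trans (sum-cong-≗ (λ i → cong (c i *_) (v≡w i x))) (comb≡0 x))

  independentOn-∘ : ∀ {Y : Set} {v : Family N X} (f : Y → X) →
    IndependentOn s (λ i → v i ∘ f) → IndependentOn s v
  independentOn-∘ f indep c c-supp comb≡0 = indep c c-supp (comb≡0 ∘ f)

  independentOn-∘-surjective : ∀ {Y : Set} {v : Family N X} (f : Y → X) → StrictlySurjective _≡_ f →
    IndependentOn s v → IndependentOn s (λ i → v i ∘ f)
  independentOn-∘-surjective {v = v} f surj indep c c-supp comb≡0 = indep c c-supp λ x →
    subst (λ y → combination c v y ≡ 0ℤ) (proj₂ (surj x)) (comb≡0 (proj₁ (surj x)))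

  independentOn-pivots : ∀ {v : Family N X} (π : ∀ i → s i ≡ true → X) →
    (∀ i sᵢ → v i (π i sᵢ) ≢ 0ℤ) → (∀ i sᵢ j → s j ≡ true → j ≢ i → v j (π i sᵢ) ≡ 0ℤ) →
    IndependentOn s v
  independentOn-pivots {v} π pivot≢0 off≡0 c c-supp comb≡0 i with s i in sᵢ
  ... | false = c-supp i sᵢ
  ... | true  = i*j≡0⇒i≡0 (pivot≢0 i sᵢ) (trans (sym (sum-δ _ i off-pivot≡0)) (comb≡0 (π i sᵢ)))
    where
    off-pivot≡0 : ∀ j → j ≢ i → c j * v j (π i sᵢ) ≡ 0ℤ
    off-pivot≡0 j j≢i with s j in sⱼ
    ... | false = i≡0⇒i*j≡0 (v j (π i sᵢ)) (c-supp j sⱼ)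
    ... | true  = j≡0⇒i*j≡0 (c j) (off≡0 i sᵢ j sⱼ j≢i)

module _ {N : ℕ} {X : Set} where

  combination-removeAt : ∀ (c : Fin (suc N) → ℤ) (v : Family (suc N) X) i x →
    combination c v x ≡ c i * v i x + combination (removeAt c i) (removeAt v i) x
  combination-removeAt c v i x = sum-remove {i = i} (λ j → c j * v j x)

  combination-insertAt : ∀ (c : Fin N → ℤ) α (v : Family (suc N) X) i x →
    combination (insertAt c i α) v x ≡ α * v i x + combination c (removeAt v i) x
  combination-insertAt c α v i x = trans (combination-removeAt (insertAt c i α) v i x)
    (cong₂ _+_ (cong (_* v i x) (insertAt-lookup c i α))
               (sum-cong-≗ (λ j → cong (_* v (punchIn i j) x) (insertAt-punchIn c i α j))))

  combination-scale : ∀ a (c : Fin N → ℤ) (v : Family N X) x →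
    combination (λ j → a * c j) v x ≡ a * combination c v x
  combination-scale a c v x =
    trans (sum-cong-≗ (λ j → ℤP.*-assoc a (c j) (v j x))) (sym (*-distribˡ-sum a (λ j → c j * v j x)))

combination-++ : ∀ {s q X} (c : Fin (s ℕ.+ q) → ℤ) (u : Family s X) (w : Family q X) x →
  combination c (u ++ w) x ≡ combination (c ∘ (_↑ˡ q)) u x + combination (c ∘ (s ↑ʳ_)) w x
combination-++ {s} {q} c u w x = trans (sum-↑ s (λ k → c k * (u ++ w) k x))
  (cong₂ _+_ (sum-cong-≗ (λ i → cong (λ f → c (i ↑ˡ q) * f x) (lookup-++ˡ u w i)))
             (sum-cong-≗ (λ j → cong (λ f → c (s ↑ʳ j) * f x) (lookup-++ʳ u w j))))

module _ {N : ℕ} {X : Set} {s : Fin (suc N) → Bool} {v : Family (suc N) X} where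

  independentOn⇒nonzero : IndependentOn s v → ∀ i → s i ≡ true → ¬ (∀ x → v i x ≡ 0ℤ)
  independentOn⇒nonzero indep i sᵢ vᵢ≡0 =
    1≢0 (trans (sym (insertAt-lookup c₀ i 1ℤ)) (indep c c-supp comb≡0 i))
    where
    c₀ : Fin N → ℤ
    c₀ _ = 0ℤ
    c = insertAt c₀ i 1ℤ
    c-supp : ∀ j → s j ≡ false → c j ≡ 0ℤ
    c-supp = ∀-punchIn i (λ sᵢ≡false → ⊥-elim (true≢false (trans (sym sᵢ) sᵢ≡false)))
                         (λ j _ → insertAt-punchIn c₀ i 1ℤ j)
    comb≡0 : ∀ x → combination c v x ≡ 0ℤ
    comb≡0 x = trans (combination-insertAt c₀ 1ℤ v i x)
      (cong₂ _+_ (trans (ℤP.*-identityˡ (v i x)) (vᵢ≡0 x)) (sum-zero (λ j → ℤP.*-zeroˡ (v (punchIn i j) x))))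

  independentOn-removeAt : ∀ i → IndependentOn s v → IndependentOn (removeAt s i) (removeAt v i)
  independentOn-removeAt i indep c c-supp comb≡0 j =
    trans (sym (insertAt-punchIn c i 0ℤ j)) (indep (insertAt c i 0ℤ) c⁺-supp comb⁺≡0 (punchIn i j))
    where
    c⁺-supp : ∀ j → s j ≡ false → insertAt c i 0ℤ j ≡ 0ℤ
    c⁺-supp = ∀-punchIn i (λ _ → insertAt-lookup c i 0ℤ)
                          (λ j sⱼ → trans (insertAt-punchIn c i 0ℤ j) (c-supp j sⱼ))
    comb⁺≡0 : ∀ x → combination (insertAt c i 0ℤ) v x ≡ 0ℤ
    comb⁺≡0 x = trans (combination-insertAt c 0ℤ v i x) (trans (ℤP.+-identityˡ _) (comb≡0 x))

  independentOn-insertAt : ∀ i → s i ≡ false → IndependentOn (removeAt s i) (removeAt v i) → IndependentOn s v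
  independentOn-insertAt i sᵢ indep c c-supp comb≡0 =
    ∀-punchIn i cᵢ≡0 (indep (removeAt c i) (c-supp ∘ punchIn i) comb'≡0)
    where
    cᵢ≡0 = c-supp i sᵢ
    comb'≡0 : ∀ x → combination (removeAt c i) (removeAt v i) x ≡ 0ℤ
    comb'≡0 x = begin
      rest                   ≡⟨ ℤP.+-identityˡ rest ⟨
      0ℤ * v i x + rest      ≡⟨ cong (λ a → a * v i x + rest) cᵢ≡0 ⟨
      c i * v i x + rest     ≡⟨ combination-removeAt c v i x ⟨
      combination c v x      ≡⟨ comb≡0 x ⟩
      0ℤ                     ∎
      where
      open ≡-Reasoning
      rest = combination (removeAt c i) (removeAt v i) x

eliminate : ∀ {N X} → Family (suc N) X → Fin (suc N) → X → Family N X
eliminate v i x₀ j x = v i x₀ * v (punchIn i j) x - v (punchIn i j) x₀ * v i x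

module _ {N : ℕ} {X : Set} {s : Fin (suc N) → Bool} {v : Family (suc N) X} (i : Fin (suc N)) (x₀ : X) where

  private
    a = v i x₀
    S : (Fin N → ℤ) → X → ℤ
    S c = combination c (removeAt v i)

  combination-eliminate : ∀ c x → combination c (eliminate v i x₀) x ≡ a * S c x - S c x₀ * v i x
  combination-eliminate c x = begin
    sum (λ j → c j * (a * w j x - w j x₀ * b))
      ≡⟨ sum-cong-≗ (λ j → regroup (c j) a (w j x) (w j x₀) b) ⟩
    sum (λ j → a * (c j * w j x) + - b * (c j * w j x₀))
      ≡⟨ sum-linear a (- b) (λ j → c j * w j x) (λ j → c j * w j x₀) ⟩
    a * S c x + - b * S c x₀
      ≡⟨ reorder a b (S c x) (S c x₀) ⟩
    a * S c x - S c x₀ * b ∎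
    where
    open ≡-Reasoning
    w = removeAt v i
    b = v i x
    regroup : ∀ c a w w₀ b → c * (a * w - w₀ * b) ≡ a * (c * w) + - b * (c * w₀)
    regroup = solve-∀
    reorder : ∀ a b S S₀ → a * S + - b * S₀ ≡ a * S - S₀ * b
    reorder = solve-∀

  independentOn-eliminate : s i ≡ true → a ≢ 0ℤ → IndependentOn s v → IndependentOn (removeAt s i) (eliminate v i x₀)
  independentOn-eliminate sᵢ a≢0 indep c c-supp comb≡0 j = i*j≡0⇒i≡0 a≢0 (begin
    c j * a                  ≡⟨ ℤP.*-comm (c j) a ⟩
    a * c j                  ≡⟨ insertAt-punchIn ac i _ j ⟨
    c⁺ (punchIn i j)         ≡⟨ indep c⁺ c⁺-supp comb⁺≡0 (punchIn i j) ⟩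
    0ℤ                       ∎)
    where
    open ≡-Reasoning
    ac : Fin N → ℤ
    ac j = a * c j
    c⁺ = insertAt ac i (- S c x₀)
    c⁺-supp : ∀ j → s j ≡ false → c⁺ j ≡ 0ℤ
    c⁺-supp = ∀-punchIn i (λ sᵢ≡false → ⊥-elim (true≢false (trans (sym sᵢ) sᵢ≡false)))
      (λ j sⱼ → trans (insertAt-punchIn ac i _ j) (j≡0⇒i*j≡0 a (c-supp j sⱼ)))
    comb⁺≡0 : ∀ x → combination c⁺ v x ≡ 0ℤ
    comb⁺≡0 x = begin
      combination c⁺ v x                   ≡⟨ combination-insertAt ac _ v i x ⟩
      - S c x₀ * v i x + S ac x            ≡⟨ cong (- S c x₀ * v i x +_) (combination-scale a c (removeAt v i) x) ⟩
      - S c x₀ * v i x + a * S c x         ≡⟨ reorder (S c x₀) (v i x) a (S c x) ⟩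
      a * S c x - S c x₀ * v i x           ≡⟨ combination-eliminate c x ⟨
      combination c (eliminate v i x₀) x   ≡⟨ comb≡0 x ⟩
      0ℤ                                   ∎
      where
      reorder : ∀ S₀ b a S → - S₀ * b + a * S ≡ a * S - S₀ * b
      reorder = solve-∀

  independentOn-uneliminate : a ≢ 0ℤ → IndependentOn (removeAt s i) (eliminate v i x₀) → IndependentOn s v
  independentOn-uneliminate a≢0 indep c c-supp comb≡0 = ∀-punchIn i cᵢ≡0 c'≡0
    where
    open ≡-Reasoning
    c' = removeAt c i
    S≡ : ∀ y → S c' y ≡ - (c i * v i y)
    S≡ y = x+y≡0⇒y≡-x (trans (sym (combination-removeAt c v i y)) (comb≡0 y))
    c'≡0 : ∀ j → c' j ≡ 0ℤ
    c'≡0 = indep c' (c-supp ∘ punchIn i) λ x → begin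
      combination c' (eliminate v i x₀) x          ≡⟨ combination-eliminate c' x ⟩
      a * S c' x - S c' x₀ * v i x                 ≡⟨ cong₂ (λ p q → a * p - q * v i x) (S≡ x) (S≡ x₀) ⟩
      a * - (c i * v i x) - - (c i * a) * v i x    ≡⟨ cancel a (c i) (v i x) ⟩
      0ℤ                                           ∎
      where
      cancel : ∀ a c b → a * - (c * b) - - (c * a) * b ≡ 0ℤ
      cancel = solve-∀
    cᵢ≡0 : c i ≡ 0ℤ
    cᵢ≡0 = i*j≡0⇒i≡0 a≢0 (begin
      c i * a                 ≡⟨ ℤP.+-identityʳ (c i * a) ⟨
      c i * a + 0ℤ            ≡⟨ cong (c i * a +_) (sum-zero (λ j → i≡0⇒i*j≡0 (removeAt v i j x₀) (c'≡0 j))) ⟨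
      c i * a + S c' x₀       ≡⟨ combination-removeAt c v i x₀ ⟨
      combination c v x₀      ≡⟨ comb≡0 x₀ ⟩
      0ℤ                      ∎)

independentOn-dropColumn : ∀ {N C} {s : Fin N → Bool} {v : Family N (Fin (suc C))} →
  (∀ i → v i zero ≡ 0ℤ) → IndependentOn s v → IndependentOn s (λ i x → v i (suc x))
independentOn-dropColumn col₀≡0 indep c c-supp comb≡0 = indep c c-supp λ
  { zero    → sum-zero (λ i → j≡0⇒i*j≡0 (c i) (col₀≡0 i))
  ; (suc x) → comb≡0 x
  }

independent⇒≤ : ∀ {N C} (v : Family N (Fin C)) → Independent v → N ≤ C
independent⇒≤ {zero}          v indep = z≤n
independent⇒≤ {suc N} {zero}  v indep = ⊥-elim (independentOn⇒nonzero {v = v} indep zero refl (λ ()))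
independent⇒≤ {suc N} {suc C} v indep with FinP.all? (λ i → v i zero ℤ.≟ 0ℤ)
... | yes col₀≡0 =
  ℕP.m≤n⇒m≤1+n (independent⇒≤ (λ i x → v i (suc x)) (independentOn-dropColumn {v = v} col₀≡0 indep))
... | no col₀≢0 with FinP.¬∀⟶∃¬ _ _ (λ i → v i zero ℤ.≟ 0ℤ) col₀≢0
...   | i , a≢0 = s≤s (independent⇒≤ (λ j x → eliminate v i zero j (suc x))
                    (independentOn-dropColumn {v = eliminate v i zero} eliminated₀≡0
                      (independentOn-eliminate {v = v} i zero refl a≢0 indep)))
  where
  eliminated₀≡0 : ∀ j → eliminate v i zero j zero ≡ 0ℤ
  eliminated₀≡0 j = cancel (v i zero) (v (punchIn i j) zero)
    where
    cancel : ∀ a b → a * b - b * a ≡ 0ℤ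
    cancel = solve-∀

dot : ∀ {C} → (Fin C → ℤ) → (Fin C → ℤ) → ℤ
dot f g = sum (λ x → f x * g x)

dot-comm : ∀ {C} (f g : Fin C → ℤ) → dot f g ≡ dot g f
dot-comm f g = sum-cong-≗ (λ x → ℤP.*-comm (f x) (g x))

dot-combinationʳ : ∀ {N C} (f : Fin C → ℤ) (c : Fin N → ℤ) (v : Family N (Fin C)) →
  dot f (combination c v) ≡ sum (λ i → c i * dot f (v i))
dot-combinationʳ f c v = begin
  sum (λ x → f x * sum (λ i → c i * v i x))     ≡⟨ sum-cong-≗ (λ x → *-distribˡ-sum (f x) (λ i → c i * v i x)) ⟩
  sum (λ x → sum (λ i → f x * (c i * v i x)))   ≡⟨ ∑-comm (λ x i → f x * (c i * v i x)) ⟩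
  sum (λ i → sum (λ x → f x * (c i * v i x)))   ≡⟨ sum-cong-≗ (λ i → sum-cong-≗ (λ x → exchange (f x) (c i) (v i x))) ⟩
  sum (λ i → sum (λ x → c i * (f x * v i x)))   ≡⟨ sum-cong-≗ (λ i → *-distribˡ-sum (c i) (λ x → f x * v i x)) ⟨
  sum (λ i → c i * dot f (v i))                 ∎
  where
  open ≡-Reasoning
  exchange : ∀ f c v → f * (c * v) ≡ c * (f * v)
  exchange = solve-∀

-- If Σ αᵢ uᵢ + z = 0 with z = Σ βⱼ wⱼ, then ⟨z , z⟩ = - ⟨z , Σ αᵢ uᵢ⟩ = 0, so z = 0.
independent-++ : ∀ {s q C} {u : Family s (Fin C)} {w : Family q (Fin C)} →
  Independent u → Independent w → (∀ i j → dot (u i) (w j) ≡ 0ℤ) → Independent (u ++ w)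
independent-++ {s} {q} {C} {u} {w} indep-u indep-w u⊥w c _ comb≡0 = ∀-↑ α≡0 β≡0
  where
  α = λ i → c (i ↑ˡ q)
  β = λ j → c (s ↑ʳ j)
  z = combination β w
  split : ∀ x → combination α u x + z x ≡ 0ℤ
  split x = trans (sym (combination-++ c u w x)) (comb≡0 x)
  u⊥z : ∀ i → dot (u i) z ≡ 0ℤ
  u⊥z i = trans (dot-combinationʳ (u i) β w) (sum-zero (λ j → j≡0⇒i*j≡0 (β j) (u⊥w i j)))
  z⊥z : dot z z ≡ 0ℤ
  z⊥z = begin
    sum (λ x → z x * z x)                    ≡⟨ sum-cong-≗ (λ x → cong (z x *_) (x+y≡0⇒y≡-x (split x))) ⟩
    sum (λ x → z x * - combination α u x)    ≡⟨ sum-cong-≗ (λ x → ℤP.neg-distribʳ-* (z x) (combination α u x)) ⟨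
    sum (λ x → - (z x * combination α u x))  ≡⟨ sum-neg (λ x → z x * combination α u x) ⟩
    - dot z (combination α u)                ≡⟨ cong -_ (dot-combinationʳ z α u) ⟩
    - sum (λ i → α i * dot z (u i))          ≡⟨ cong -_ (sum-zero (λ i → j≡0⇒i*j≡0 (α i) (trans (dot-comm z (u i)) (u⊥z i)))) ⟩
    0ℤ                                       ∎
    where open ≡-Reasoning
  z≡0 = sum-squares≡0⇒≡0 z z⊥z
  β≡0 = indep-w β (λ _ ()) z≡0
  α≡0 = indep-u α (λ _ ()) λ x →
    trans (sym (ℤP.+-identityʳ _)) (trans (cong (combination α u x +_) (sym (z≡0 x))) (split x))

-- Polynomial families

eval : List ℤ → ℤ → ℤ
eval []      t = 0ℤ
eval (a ∷ p) t = a + t * eval p t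

infixl 6 _⊕_
infixl 7 _⊛_

_⊕_ : List ℤ → List ℤ → List ℤ
[]      ⊕ q       = q
(a ∷ p) ⊕ []      = a ∷ p
(a ∷ p) ⊕ (b ∷ q) = a + b ∷ p ⊕ q

_⊛_ : List ℤ → List ℤ → List ℤ
[]      ⊛ q = []
(a ∷ p) ⊛ q = map (a *_) q ⊕ (0ℤ ∷ p ⊛ q)

eval-⊕ : ∀ p q t → eval (p ⊕ q) t ≡ eval p t + eval q t
eval-⊕ []      q       t = sym (ℤP.+-identityˡ (eval q t))
eval-⊕ (a ∷ p) []      t = sym (ℤP.+-identityʳ (a + t * eval p t))
eval-⊕ (a ∷ p) (b ∷ q) t =
  trans (cong (λ e → a + b + t * e) (eval-⊕ p q t)) (regroup a b t (eval p t) (eval q t))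
  where
  regroup : ∀ a b t P Q → a + b + t * (P + Q) ≡ a + t * P + (b + t * Q)
  regroup = solve-∀

eval-map : ∀ a q t → eval (map (a *_) q) t ≡ a * eval q t
eval-map a []      t = sym (ℤP.*-zeroʳ a)
eval-map a (b ∷ q) t = trans (cong (λ e → a * b + t * e) (eval-map a q t)) (regroup a b t (eval q t))
  where
  regroup : ∀ a b t Q → a * b + t * (a * Q) ≡ a * (b + t * Q)
  regroup = solve-∀

eval-⊛ : ∀ p q t → eval (p ⊛ q) t ≡ eval p t * eval q t
eval-⊛ []      q t = sym (ℤP.*-zeroˡ (eval q t))
eval-⊛ (a ∷ p) q t = begin
  eval (map (a *_) q ⊕ (0ℤ ∷ p ⊛ q)) t              ≡⟨ eval-⊕ (map (a *_) q) (0ℤ ∷ p ⊛ q) t ⟩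
  eval (map (a *_) q) t + (0ℤ + t * eval (p ⊛ q) t) ≡⟨ cong₂ (λ x y → x + (0ℤ + t * y)) (eval-map a q t)
                                                                                           (eval-⊛ p q t) ⟩
  a * eval q t + (0ℤ + t * (eval p t * eval q t))   ≡⟨ regroup a t (eval p t) (eval q t) ⟩
  (a + t * eval p t) * eval q t                     ∎
  where
  open ≡-Reasoning
  regroup : ∀ a t P Q → a * Q + (0ℤ + t * (P * Q)) ≡ (a + t * P) * Q
  regroup = solve-∀

Polynomial : (ℤ → ℤ) → Set
Polynomial f = Σ (List ℤ) λ p → ∀ t → eval p t ≡ f t

polynomial-const : ∀ a → Polynomial (λ _ → a)
polynomial-const a = a ∷ [] , evaluate a
  where
  evaluate : ∀ a t → a + t * 0ℤ ≡ a
  evaluate = solve-∀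

polynomial-id : Polynomial (λ t → t)
polynomial-id = 0ℤ ∷ 1ℤ ∷ [] , evaluate
  where
  evaluate : ∀ t → 0ℤ + t * (1ℤ + t * 0ℤ) ≡ t
  evaluate = solve-∀

polynomial-+ : ∀ {f g} → Polynomial f → Polynomial g → Polynomial (λ t → f t + g t)
polynomial-+ (p , p≡f) (q , q≡g) = p ⊕ q , λ t → trans (eval-⊕ p q t) (cong₂ _+_ (p≡f t) (q≡g t))

polynomial-* : ∀ {f g} → Polynomial f → Polynomial g → Polynomial (λ t → f t * g t)
polynomial-* (p , p≡f) (q , q≡g) = p ⊛ q , λ t → trans (eval-⊛ p q t) (cong₂ _*_ (p≡f t) (q≡g t))

polynomial-neg : ∀ {f} → Polynomial f → Polynomial (λ t → - f t)
polynomial-neg {f} poly with polynomial-* (polynomial-const -1ℤ) poly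
... | p , p≡-f = p , λ t → trans (p≡-f t) (ℤP.-1*i≡-i (f t))

polynomial-- : ∀ {f g} → Polynomial f → Polynomial g → Polynomial (λ t → f t - g t)
polynomial-- poly-f poly-g = polynomial-+ poly-f (polynomial-neg poly-g)

polynomial-if : ∀ b {f} → Polynomial f → Polynomial (λ t → if b then f t else 0ℤ)
polynomial-if true  poly = poly
polynomial-if false poly = polynomial-const 0ℤ

Eventually : (ℕ → Set) → Set
Eventually P = ∃[ N ] ∀ t → N ≤ t → P t

eventually-× : ∀ {P Q : ℕ → Set} → Eventually P → Eventually Q → Eventually (λ t → P t × Q t)
eventually-× (N , P≥N) (M , Q≥M) = N ⊔ M , λ t N⊔M≤t →
  P≥N t (ℕP.≤-trans (ℕP.m≤m⊔n N M) N⊔M≤t) , Q≥M t (ℕP.≤-trans (ℕP.m≤n⊔m N M) N⊔M≤t)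

eventually-map : ∀ {P Q : ℕ → Set} → (∀ t → P t → Q t) → Eventually P → Eventually Q
eventually-map P⇒Q (N , P≥N) = N , λ t N≤t → P⇒Q t (P≥N t N≤t)

eventually⇒∃ : ∀ {P : ℕ → Set} → Eventually P → ∃ P
eventually⇒∃ (N , P≥N) = N , P≥N N ℕP.≤-refl

a+t*e≢0 : ∀ a e {t} → ∣ a ∣ < t → e ≢ 0ℤ → a + ℤ.+ t * e ≢ 0ℤ
a+t*e≢0 a e {t} ∣a∣<t e≢0 a+te≡0 = ℕP.<⇒≱ ∣a∣<t (begin
  t                    ≤⟨ ℕP.m≤m*n t ∣ e ∣ {{ℤ.≢-nonZero e≢0}} ⟩
  t ℕ.* ∣ e ∣          ≡⟨ ℤP.abs-* (ℤ.+ t) e ⟨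
  ∣ ℤ.+ t * e ∣        ≡⟨ cong ∣_∣ (x+y≡0⇒y≡-x {a} {ℤ.+ t * e} a+te≡0) ⟩
  ∣ - a ∣              ≡⟨ ℤP.∣-i∣≡∣i∣ a ⟩
  ∣ a ∣                ∎)
  where open ℕP.≤-Reasoning

eval-zeros : ∀ {p} → All (_≡ 0ℤ) p → ∀ t → eval p t ≡ 0ℤ
eval-zeros []             t = refl
eval-zeros (refl ∷ zeros) t = trans (ℤP.+-identityˡ _) (j≡0⇒i*j≡0 t (eval-zeros zeros t))

eval≢0⇒nonzero : ∀ p t → eval p t ≢ 0ℤ → Any (_≢ 0ℤ) p
eval≢0⇒nonzero []      t eval≢0 = ⊥-elim (eval≢0 refl)
eval≢0⇒nonzero (a ∷ p) t eval≢0 with a ℤ.≟ 0ℤ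
... | no a≢0   = here a≢0
... | yes refl = there (eval≢0⇒nonzero p t λ p≡0 → eval≢0 (trans (ℤP.+-identityˡ _) (j≡0⇒i*j≡0 t p≡0)))

eventually-nonzero-eval : ∀ p → Any (_≢ 0ℤ) p → Eventually (λ t → eval p (ℤ.+ t) ≢ 0ℤ)
eventually-nonzero-eval (a ∷ q) nonzero with Any.any? (λ b → ¬? (b ℤ.≟ 0ℤ)) q
... | yes q-nonzero = eventually-map (λ t (q≢0 , ∣a∣<t) → a+t*e≢0 a (eval q (ℤ.+ t)) ∣a∣<t q≢0)
  (eventually-× (eventually-nonzero-eval q q-nonzero) (suc ∣ a ∣ , λ _ ∣a∣<t → ∣a∣<t))
... | no q-zero = 0 , λ t _ → subst (_≢ 0ℤ) (sym (eval≡a t)) a≢0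
  where
  zeros : All (_≡ 0ℤ) q
  zeros = All.map (decidable-stable (_ ℤ.≟ 0ℤ)) (¬Any⇒All¬ q q-zero)
  a≢0 : a ≢ 0ℤ
  a≢0 = [ id , ⊥-elim ∘ q-zero ]′ (Any.toSum nonzero)
  eval≡a : ∀ t → eval (a ∷ q) (ℤ.+ t) ≡ a
  eval≡a t = trans (cong (a +_) (j≡0⇒i*j≡0 (ℤ.+ t) (eval-zeros zeros (ℤ.+ t)))) (ℤP.+-identityʳ a)

eventually-nonzero : ∀ {f} → Polynomial f → ∀ t₀ → f t₀ ≢ 0ℤ → Eventually (λ t → f (ℤ.+ t) ≢ 0ℤ)
eventually-nonzero (p , p≡f) t₀ f≢0 = eventually-map (λ t e≢0 → subst (_≢ 0ℤ) (p≡f (ℤ.+ t)) e≢0)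
  (eventually-nonzero-eval p (eval≢0⇒nonzero p t₀ (subst (_≢ 0ℤ) (sym (p≡f t₀)) f≢0)))

-- Elimination against a pivot polynomial that is nonzero at t₀ keeps all entries polynomial.
eventually-independentOn : ∀ {N C} (s : Fin N → Bool) (u : ℤ → Family N (Fin C)) →
  (∀ i x → Polynomial (λ t → u t i x)) → ∀ t₀ → IndependentOn s (u t₀) →
  Eventually (λ t → IndependentOn s (u (ℤ.+ t)))
eventually-independentOn {zero}  s u poly t₀ _ = 0 , λ _ _ _ _ _ ()
eventually-independentOn {suc N} s u poly t₀ indep with s zero in s₀
... | false = eventually-map (λ t → independentOn-insertAt {v = u (ℤ.+ t)} zero s₀)
  (eventually-independentOn (removeAt s zero) (λ t → removeAt (u t) zero) (poly ∘ suc) t₀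
    (independentOn-removeAt {v = u t₀} zero indep))
... | true with FinP.all? (λ x → u t₀ zero x ℤ.≟ 0ℤ)
...   | yes row≡0 = ⊥-elim (independentOn⇒nonzero {v = u t₀} indep zero s₀ row≡0)
...   | no row≢0 with FinP.¬∀⟶∃¬ _ _ (λ x → u t₀ zero x ℤ.≟ 0ℤ) row≢0
...     | x₀ , a≢0 =
  eventually-map (λ t (a≢0 , indep') → independentOn-uneliminate {v = u (ℤ.+ t)} zero x₀ a≢0 indep')
    (eventually-× (eventually-nonzero (poly zero x₀) t₀ a≢0)
                  (eventually-independentOn (removeAt s zero) (λ t → eliminate (u t) zero x₀) poly-eliminated t₀
                    (independentOn-eliminate {v = u t₀} zero x₀ s₀ a≢0 indep)))
  where
  poly-eliminated : ∀ j x → Polynomial (λ t → eliminate (u t) zero x₀ j x)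
  poly-eliminated j x =
    polynomial-- (polynomial-* (poly zero x₀) (poly (suc j) x)) (polynomial-* (poly (suc j) x₀) (poly zero x))

independent-at-common-point : ∀ {N M C D} {s : Fin N → Bool} {s' : Fin M → Bool}
  (u : ℤ → Family N (Fin C)) (w : ℤ → Family M (Fin D)) →
  (∀ i x → Polynomial (λ t → u t i x)) → (∀ j y → Polynomial (λ t → w t j y)) →
  ∀ t₀ t₁ → IndependentOn s (u t₀) → IndependentOn s' (w t₁) →
  ∃[ t ] IndependentOn s (u (ℤ.+ t)) × IndependentOn s' (w (ℤ.+ t))
independent-at-common-point {s = s} {s'} u w poly-u poly-w t₀ t₁ indep-u indep-w = eventually⇒∃
  (eventually-× (eventually-independentOn s u poly-u t₀ indep-u) (eventually-independentOn s' w poly-w t₁ indep-w))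

-- The rigidity matrix

if-yes : ∀ {A : Set} (d : Dec A) x → A → (if ⌊ d ⌋ then x else 0ℤ) ≡ x
if-yes d x a = cong (if_then x else 0ℤ) (trans (isYes≗does d) (dec-true d a))

if-no : ∀ {A : Set} (d : Dec A) x → ¬ A → (if ⌊ d ⌋ then x else 0ℤ) ≡ 0ℤ
if-no d x ¬a = cong (if_then x else 0ℤ) (trans (isYes≗does d) (dec-false d ¬a))

sum-if : ∀ {r} (x : Fin r → ℤ) (p₀ : Fin r) y → sum (λ p → x p * (if ⌊ p₀ Fin.≟ p ⌋ then y else 0ℤ)) ≡ x p₀ * y
sum-if x p₀ y = trans (sum-δ _ p₀ (λ p p≢p₀ → j≡0⇒i*j≡0 (x p) (if-no (p₀ Fin.≟ p) y (p≢p₀ ∘ sym))))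
                      (cong (x p₀ *_) (if-yes (p₀ Fin.≟ p₀) y refl))

sum-if² : ∀ {n r} (a : Fin n) (x : Fin r → ℤ) (h : Fin n → Fin r → ℤ) →
  sum (λ a' → sum (λ p → (if ⌊ a Fin.≟ a' ⌋ then x p else 0ℤ) * h a' p)) ≡ sum (λ p → x p * h a p)
sum-if² a x h = trans (sum-δ _ a off≡0) (sum-cong-≗ (λ p → cong (_* h a p) (if-yes (a Fin.≟ a) (x p) refl)))
  where
  off≡0 : ∀ a' → a' ≢ a → sum (λ p → (if ⌊ a Fin.≟ a' ⌋ then x p else 0ℤ) * h a' p) ≡ 0ℤ
  off≡0 a' a'≢a = sum-zero (λ p → i≡0⇒i*j≡0 (h a' p) (if-no (a Fin.≟ a') (x p) (a'≢a ∘ sym)))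

module _ {k l n m : ℕ} where

  colAt : Fin (n ℕ.* l ℕ.+ m ℕ.* k) → Col k l n m
  colAt x = [ inj₁ ∘ remQuot l , inj₂ ∘ remQuot k ]′ (splitAt (n ℕ.* l) x)

  colAt-surjective : StrictlySurjective _≡_ colAt
  colAt-surjective (inj₁ (a , p)) = combine a p ↑ˡ (m ℕ.* k) ,
    trans (cong [ inj₁ ∘ remQuot l , inj₂ ∘ remQuot k ]′ (FinP.splitAt-↑ˡ _ (combine a p) _))
          (cong inj₁ (FinP.remQuot-combine a p))
  colAt-surjective (inj₂ (b , q)) = (n ℕ.* l) ↑ʳ combine b q ,
    trans (cong [ inj₁ ∘ remQuot l , inj₂ ∘ remQuot k ]′ (FinP.splitAt-↑ʳ _ _ (combine b q)))
          (cong inj₂ (FinP.remQuot-combine b q))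

  sum-colAt : ∀ (h : Col k l n m → ℤ) →
    sum (h ∘ colAt) ≡ sum (λ a → sum (λ p → h (inj₁ (a , p)))) + sum (λ b → sum (λ q → h (inj₂ (b , q))))
  sum-colAt h = trans (sum-↑ (n ℕ.* l) (h ∘ colAt)) (cong₂ _+_
    (trans (sum-cong-≗ (λ y → cong h′ (FinP.splitAt-↑ˡ _ y _))) (sum-remQuot n (h ∘ inj₁)))
    (trans (sum-cong-≗ (λ y → cong h′ (FinP.splitAt-↑ʳ _ _ y))) (sum-remQuot m (h ∘ inj₂))))
    where
    h′ = h ∘ [ inj₁ ∘ remQuot l , inj₂ ∘ remQuot k ]′

module _ {k l n m : ℕ} (θA : Fin k → Fin n → ℤ) where

  entry-cong : ∀ {θB θB' : Fin l → Fin m → ℤ} → (∀ p b → θB p b ≡ θB' p b) → ∀ e col →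
    entry θA θB e col ≡ entry θA θB' e col
  entry-cong θB≡θB' (a , b) (inj₁ (a' , p)) = cong (if ⌊ a Fin.≟ a' ⌋ then_else 0ℤ) (θB≡θB' p b)
  entry-cong θB≡θB' (a , b) (inj₂ _)        = refl

  entry-polynomial : ∀ (θB : ℤ → Fin l → Fin m → ℤ) → (∀ p b → Polynomial (λ t → θB t p b)) → ∀ e col →
    Polynomial (λ t → entry θA (θB t) e col)
  entry-polynomial θB poly (a , b) (inj₁ (a' , p)) = polynomial-if ⌊ a Fin.≟ a' ⌋ (poly p b)
  entry-polynomial θB poly (a , b) (inj₂ (b' , q)) = polynomial-if ⌊ b Fin.≟ b' ⌋ (polynomial-const (θA q a))

  trivialMotion : (Fin l → Fin m → ℤ) → Fin k × Fin l → Col k l n m → ℤ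
  trivialMotion θB (q₀ , p₀) (inj₁ (a , p)) = if ⌊ p₀ Fin.≟ p ⌋ then θA q₀ a else 0ℤ
  trivialMotion θB (q₀ , p₀) (inj₂ (b , q)) = if ⌊ q₀ Fin.≟ q ⌋ then - θB p₀ b else 0ℤ

  trivialMotion-cong : ∀ {θB θB' : Fin l → Fin m → ℤ} → (∀ p b → θB p b ≡ θB' p b) → ∀ qp col →
    trivialMotion θB qp col ≡ trivialMotion θB' qp col
  trivialMotion-cong θB≡θB' qp        (inj₁ _)       = refl
  trivialMotion-cong θB≡θB' (q₀ , p₀) (inj₂ (b , q)) =
    cong (λ y → if ⌊ q₀ Fin.≟ q ⌋ then - y else 0ℤ) (θB≡θB' p₀ b)

  trivialMotion-polynomial : ∀ (θB : ℤ → Fin l → Fin m → ℤ) → (∀ p b → Polynomial (λ t → θB t p b)) →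
    ∀ qp col → Polynomial (λ t → trivialMotion (θB t) qp col)
  trivialMotion-polynomial θB poly (q₀ , p₀) (inj₁ (a , p)) =
    polynomial-if ⌊ p₀ Fin.≟ p ⌋ (polynomial-const (θA q₀ a))
  trivialMotion-polynomial θB poly (q₀ , p₀) (inj₂ (b , q)) =
    polynomial-if ⌊ q₀ Fin.≟ q ⌋ (polynomial-neg (poly p₀ b))

  module _ (θB : Fin l → Fin m → ℤ) where

    dot-entry : ∀ a b (w : Col k l n m → ℤ) →
      sum (λ x → entry θA θB (a , b) (colAt x) * w (colAt x)) ≡
      sum (λ p → θB p b * w (inj₁ (a , p))) + sum (λ q → θA q a * w (inj₂ (b , q)))
    dot-entry a b w = trans (sum-colAt (λ col → entry θA θB (a , b) col * w col))
      (cong₂ _+_ (sum-if² a (λ p → θB p b) (λ a' p → w (inj₁ (a' , p))))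
                 (sum-if² b (λ q → θA q a) (λ b' q → w (inj₂ (b' , q)))))

    entry⊥trivialMotion : ∀ e qp → sum (λ x → entry θA θB e (colAt x) * trivialMotion θB qp (colAt x)) ≡ 0ℤ
    entry⊥trivialMotion (a , b) (q₀ , p₀) = begin
      sum (λ x → entry θA θB (a , b) (colAt x) * motion (colAt x))
        ≡⟨ dot-entry a b motion ⟩
      sum (λ p → θB p b * motion (inj₁ (a , p))) + sum (λ q → θA q a * motion (inj₂ (b , q)))
        ≡⟨ cong₂ _+_ (sum-if (λ p → θB p b) p₀ (θA q₀ a)) (sum-if (λ q → θA q a) q₀ (- θB p₀ b)) ⟩
      θB p₀ b * θA q₀ a + θA q₀ a * - θB p₀ b
        ≡⟨ cancel (θB p₀ b) (θA q₀ a) ⟩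
      0ℤ ∎
      where
      open ≡-Reasoning
      motion = trivialMotion θB (q₀ , p₀)
      cancel : ∀ x y → x * y + y * - x ≡ 0ℤ
      cancel = solve-∀

segment : ∀ {l m} → (θ Γ : Fin l → Fin m → ℤ) → ℤ → Fin l → Fin m → ℤ
segment θ Γ t p b = θ p b + t * (Γ p b - θ p b)

module _ {l m} (θ Γ : Fin l → Fin m → ℤ) where

  segment-0 : ∀ p b → segment θ Γ 0ℤ p b ≡ θ p b
  segment-0 p b = ℤP.+-identityʳ (θ p b)

  segment-1 : ∀ p b → segment θ Γ 1ℤ p b ≡ Γ p b
  segment-1 p b = endpoint (θ p b) (Γ p b)
    where
    endpoint : ∀ x y → x + 1ℤ * (y - x) ≡ y
    endpoint = solve-∀

  segment-polynomial : ∀ p b → Polynomial (λ t → segment θ Γ t p b)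
  segment-polynomial p b =
    polynomial-+ (polynomial-const (θ p b)) (polynomial-* polynomial-id (polynomial-const (Γ p b - θ p b)))

module _ {k l n m r : ℕ} (θA : Fin k → Fin n → ℤ) (θB Γ : Fin l → Fin m → ℤ) (f : Fin r → Fin n × Fin m) where

  rowsOnSegment : ℤ → Family r (Fin (n ℕ.* l ℕ.+ m ℕ.* k))
  rowsOnSegment t i x = entry θA (segment θB Γ t) (f i) (colAt x)

  rowsOnSegment-polynomial : ∀ i x → Polynomial (λ t → rowsOnSegment t i x)
  rowsOnSegment-polynomial i x = entry-polynomial θA (segment θB Γ) (segment-polynomial θB Γ) (f i) (colAt x)

  independentOn-rowsOnSegment : ∀ {s} → IndependentOn s (λ i → entry θA θB (f i)) → IndependentOn s (rowsOnSegment 0ℤ)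
  independentOn-rowsOnSegment indep = independentOn-∘-surjective colAt colAt-surjective
    (independentOn-cong (λ i col → entry-cong θA (λ p b → sym (segment-0 θB Γ p b)) (f i) col) indep)

basisAlong : ∀ {l m} → (Fin l → Fin m) → Fin l → Fin m → ℤ
basisAlong g p b = if ⌊ g p Fin.≟ b ⌋ then 1ℤ else 0ℤ

module _ {l m} {g : Fin l → Fin m} (g-inj : Injective _≡_ _≡_ g) where

  basisAlong-independent : Independent (λ j p → basisAlong g p (g j))
  basisAlong-independent = independentOn-pivots (λ j _ → j)
    (λ j _ → subst (_≢ 0ℤ) (sym (if-yes (g j Fin.≟ g j) 1ℤ refl)) 1≢0)
    (λ j _ j' _ j'≢j → if-no (g j Fin.≟ g j') 1ℤ (j'≢j ∘ sym ∘ g-inj))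

  trivialMotions-independent : ∀ {k n} (θA : Fin k → Fin n → ℤ) →
    Independent (λ t → trivialMotion θA (basisAlong g) (remQuot l t))
  trivialMotions-independent {k} {n} θA = independentOn-pivots (λ t _ → pivot (remQuot l t))
    (λ t _ → pivot≢0 (remQuot l t))
    (λ t _ t' _ t'≢t → off≡0 (remQuot l t) (remQuot l t') (t'≢t ∘ remQuot-injective t' t))
    where
    motion = trivialMotion θA (basisAlong g)
    pivot : Fin k × Fin l → Col k l n m
    pivot (q₀ , p₀) = inj₂ (g p₀ , q₀)
    pivot≢0 : ∀ qp → motion qp (pivot qp) ≢ 0ℤ
    pivot≢0 (q₀ , p₀) rewrite if-yes (q₀ Fin.≟ q₀) (- basisAlong g p₀ (g p₀)) refl
                            | if-yes (g p₀ Fin.≟ g p₀) 1ℤ refl = λ ()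
    off≡0 : ∀ qp qp' → qp' ≢ qp → motion qp' (pivot qp) ≡ 0ℤ
    off≡0 (q₀ , p₀) (q , p) qp'≢qp with q Fin.≟ q₀ | p Fin.≟ p₀
    ... | no _     | _        = refl
    ... | yes refl | yes refl = ⊥-elim (qp'≢qp refl)
    ... | yes refl | no p≢p₀  = cong -_ (if-no (g p Fin.≟ g p₀) 1ℤ (p≢p₀ ∘ g-inj))
    remQuot-injective : ∀ t t' → remQuot {k} l t ≡ remQuot l t' → t ≡ t'
    remQuot-injective t t' eq =
      trans (sym (FinP.combine-remQuot {k} l t)) (trans (cong (uncurry combine) eq) (FinP.combine-remQuot {k} l t'))

position : ∀ {m} → (Fin m → Bool) → Fin m → ℕ
position s zero    = 0
position s (suc b) = (if s zero then 1 else 0) ℕ.+ position (s ∘ suc) b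

position<count : ∀ {m} (s : Fin m → Bool) b → s b ≡ true → position s b < count s
position<count s zero    s₀  rewrite s₀ = s≤s z≤n
position<count s (suc b) s_b = ℕP.+-monoʳ-< (if s zero then 1 else 0) (position<count (s ∘ suc) b s_b)

position-injective : ∀ {m} (s : Fin m → Bool) {b b'} → s b ≡ true → s b' ≡ true →
  position s b ≡ position s b' → b ≡ b'
position-injective s {zero}  {zero}   _   _    _  = refl
position-injective s {zero}  {suc b'} s₀  _    eq rewrite s₀ = ⊥-elim (ℕP.0≢1+n eq)
position-injective s {suc b} {zero}   _   s₀   eq rewrite s₀ = ⊥-elim (ℕP.0≢1+n (sym eq))
position-injective s {suc b} {suc b'} s_b s_b' eq =
  cong suc (position-injective (s ∘ suc) s_b s_b' (ℕP.+-cancelˡ-≡ (if s zero then 1 else 0) _ _ eq))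

-- The i-th selected column is the i-th unit vector.
basisOn : ∀ {l m} → (Fin m → Bool) → Fin l → Fin m → ℤ
basisOn s p b = if ⌊ toℕ p ℕ.≟ position s b ⌋ then 1ℤ else 0ℤ

basisOn-independent : ∀ {l m} (s : Fin m → Bool) → count s ≤ l → IndependentOn s (λ b p → basisOn {l} s p b)
basisOn-independent s count≤l = independentOn-pivots pivot
  (λ b s_b → subst (_≢ 0ℤ) (sym (if-yes (_ ℕ.≟ position s b) 1ℤ (FinP.toℕ-fromℕ< _))) 1≢0)
  (λ b s_b b' s_b' b'≢b → if-no (_ ℕ.≟ position s b') 1ℤ
     (λ eq → b'≢b (position-injective s s_b' s_b (trans (sym eq) (FinP.toℕ-fromℕ< _)))))
  where
  pivot : ∀ b → s b ≡ true → Fin _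
  pivot b s_b = fromℕ< (ℕP.<-≤-trans (position<count s b s_b) count≤l)

edges : ∀ {n m} → BGraph n m → Fin (n ℕ.* m) → Bool
edges {n} {m} G t = uncurry G (remQuot {n} m t)

module _ {k l n m : ℕ} (θA : Fin k → Fin n → ℤ) (θB : Fin l → Fin m → ℤ) where

  entry-own-column : ∀ a b p → entry θA θB (a , b) (inj₁ (a , p)) ≡ θB p b
  entry-own-column a b p = if-yes (a Fin.≟ a) (θB p b) refl

  entry-foreign-column : ∀ {a a'} b p → a ≢ a' → entry θA θB (a , b) (inj₁ (a' , p)) ≡ 0ℤ
  entry-foreign-column {a} {a'} b p a≢a' = if-no (a Fin.≟ a') (θB p b) a≢a'

  sumℤ-independent⇒independent : ∀ {r} (f : Fin r → Fin n × Fin m) →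
    ((c : Fin r → ℤ) → (∀ col → sumℤ (λ i → c i * entry θA θB (f i) col) ≡ 0ℤ) → ∀ i → c i ≡ 0ℤ) →
    Independent (λ i → entry θA θB (f i))
  sumℤ-independent⇒independent f indep c _ comb≡0 =
    indep c (λ col → trans (sumℤ≡sum (λ i → c i * entry θA θB (f i) col)) (comb≡0 col))

  independent⇒sumℤ-independent : ∀ {r} (f : Fin r → Fin n × Fin m) → Independent (λ i → entry θA θB (f i)) →
    (c : Fin r → ℤ) → (∀ col → sumℤ (λ i → c i * entry θA θB (f i) col) ≡ 0ℤ) → ∀ i → c i ≡ 0ℤ
  independent⇒sumℤ-independent f indep c sums≡0 =
    indep c (λ _ ()) (λ col → trans (sym (sumℤ≡sum (λ i → c i * entry θA θB (f i) col))) (sums≡0 col))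

  allRows : Family (n ℕ.* m) (Col k l n m)
  allRows t = entry θA θB (remQuot m t)

  combination-allRows : ∀ (C : Fin n → Fin m → ℤ) col →
    combination (λ t → uncurry C (remQuot m t)) allRows col ≡
    sumℤ (λ a → sumℤ (λ b → C a b * entry θA θB (a , b) col))
  combination-allRows C col = trans (sum-remQuot n (λ e → uncurry C e * entry θA θB e col))
    (sym (sumℤ²≡sum² (λ a b → C a b * entry θA θB (a , b) col)))

  rowsIndependent⇒independentOn : ∀ {G} → RowsIndependent k l G θA θB → IndependentOn (edges G) allRows
  rowsIndependent⇒independentOn {G} indep c c-supp comb≡0 t = begin
    c t                                ≡⟨ cong c (FinP.combine-remQuot {n} m t) ⟨
    uncurry C (remQuot m t)            ≡⟨ indep C C-supp sums≡0 (proj₁ (remQuot {n} m t)) (proj₂ (remQuot {n} m t)) ⟩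
    0ℤ                                 ∎
    where
    open ≡-Reasoning
    C : Fin n → Fin m → ℤ
    C a b = c (combine a b)
    C-supp : ∀ a b → G a b ≡ false → C a b ≡ 0ℤ
    C-supp a b G≡false = c-supp (combine a b) (trans (cong (uncurry G) (FinP.remQuot-combine a b)) G≡false)
    sums≡0 : ∀ col → sumℤ (λ a → sumℤ (λ b → C a b * entry θA θB (a , b) col)) ≡ 0ℤ
    sums≡0 col = trans (sym (combination-allRows C col))
      (trans (sum-cong-≗ (λ t → cong (λ t' → c t' * allRows t col) (FinP.combine-remQuot {n} m t))) (comb≡0 col))

  independentOn⇒rowsIndependent : ∀ {G} → IndependentOn (edges G) allRows → RowsIndependent k l G θA θB
  independentOn⇒rowsIndependent indep C C-supp sums≡0 a b = trans (cong (uncurry C) (sym (FinP.remQuot-combine a b)))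
    (indep (λ t → uncurry C (remQuot m t)) (λ t → C-supp _ _) (λ col → trans (combination-allRows C col) (sums≡0 col))
      (combine a b))

-- Adding a vertex

pick : ∀ {m l} (s : Fin m → Bool) → l ≤ count s →
  Σ (Fin l → Fin m) λ g → Injective _≡_ _≡_ g × (∀ i → s (g i) ≡ true)
pick {zero}  s z≤n = (λ ()) , (λ { {()} }) , (λ ())
pick {suc m} s l≤count with s zero in s₀
... | false = let g , g-inj , g-sel = pick (s ∘ suc) l≤count in suc ∘ g , g-inj ∘ FinP.suc-injective , g-sel
pick {suc m} {zero}  s _       | true = (λ ()) , (λ { {()} }) , (λ ())
pick {suc m} {suc l} s l≤count | true with pick (s ∘ suc) (ℕP.≤-pred l≤count)
... | g , g-inj , g-sel = g⁺ , g⁺-inj , g⁺-sel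
  where
  g⁺ : Fin (suc l) → Fin (suc m)
  g⁺ zero    = zero
  g⁺ (suc i) = suc (g i)
  g⁺-inj : Injective _≡_ _≡_ g⁺
  g⁺-inj {zero}  {zero}  _  = refl
  g⁺-inj {suc i} {suc j} eq = cong suc (g-inj (FinP.suc-injective eq))
  g⁺-sel : ∀ i → s (g⁺ i) ≡ true
  g⁺-sel zero    = s₀
  g⁺-sel (suc i) = g-sel i

zeroAt : ∀ {k n} → Fin (suc n) → (Fin k → Fin n → ℤ) → Fin k → Fin (suc n) → ℤ
zeroAt v θA q = insertAt (θA q) v 0ℤ

liftCol : ∀ {k l n m} → Fin (suc n) → Col k l n m → Col k l (suc n) m
liftCol v (inj₁ (a , p)) = inj₁ (punchIn v a , p)
liftCol v (inj₂ bq)      = inj₂ bq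

liftEdge : ∀ {n m} → Fin (suc n) → Fin n × Fin m → Fin (suc n) × Fin m
liftEdge v (a , b) = punchIn v a , b

module _ {k l n m : ℕ} (v : Fin (suc n)) (θA : Fin k → Fin n → ℤ) (θB : Fin l → Fin m → ℤ) where

  private
    θA⁺ = zeroAt v θA

  entry-liftCol : ∀ a b col → entry θA⁺ θB (punchIn v a , b) (liftCol v col) ≡ entry θA θB (a , b) col
  entry-liftCol a b (inj₁ (a' , p)) with a Fin.≟ a'
  ... | yes refl = if-yes (punchIn v a Fin.≟ punchIn v a) (θB p b) refl
  ... | no a≢a'  = if-no (punchIn v a Fin.≟ punchIn v a') (θB p b) (a≢a' ∘ FinP.punchIn-injective v a a')
  entry-liftCol a b (inj₂ (b' , q)) = cong (if ⌊ b Fin.≟ b' ⌋ then_else 0ℤ) (insertAt-punchIn (θA q) v 0ℤ a)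

  entry-v-liftCol : ∀ b col → entry θA⁺ θB (v , b) (liftCol v col) ≡ 0ℤ
  entry-v-liftCol b (inj₁ (a' , p)) = entry-foreign-column θA⁺ θB b p (FinP.punchInᵢ≢i v a' ∘ sym)
  entry-v-liftCol b (inj₂ (b' , q)) rewrite insertAt-lookup (θA q) v 0ℤ with ⌊ b Fin.≟ b' ⌋
  ... | true  = refl
  ... | false = refl

  rowsIndependent-addVertex : ∀ (G : BGraph (suc n) m) → RowsIndependent k l (deleteA G v) θA θB →
    IndependentOn (G v) (λ b p → θB p b) → RowsIndependent k l G θA⁺ θB
  rowsIndependent-addVertex G indep' indepᵥ c c-supp stress≡0 = ∀-punchIn v cᵥ≡0 c'≡0
    where
    open ≡-Reasoning
    Rᵥ R' : Col k l (suc n) m → ℤ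
    Rᵥ col = sum (λ b → c v b * entry θA⁺ θB (v , b) col)
    R' col = sum (λ a → sum (λ b → c (punchIn v a) b * entry θA⁺ θB (punchIn v a , b) col))
    Rᵥ+R'≡0 : ∀ col → Rᵥ col + R' col ≡ 0ℤ
    Rᵥ+R'≡0 col = trans (sym (sum-remove {i = v} (λ a → sum (λ b → c a b * entry θA⁺ θB (a , b) col))))
      (trans (sym (sumℤ²≡sum² (λ a b → c a b * entry θA⁺ θB (a , b) col))) (stress≡0 col))
    cᵥ≡0 : ∀ b → c v b ≡ 0ℤ
    cᵥ≡0 = indepᵥ (c v) (c-supp v) λ p → begin
      sum (λ b → c v b * θB p b)
        ≡⟨ sum-cong-≗ (λ b → cong (c v b *_) (entry-own-column θA⁺ θB v b p)) ⟨
      Rᵥ (inj₁ (v , p))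
        ≡⟨ ℤP.+-identityʳ _ ⟨
      Rᵥ (inj₁ (v , p)) + 0ℤ
        ≡⟨ cong (Rᵥ (inj₁ (v , p)) +_) (sum-zero (λ a → sum-zero (λ b →
             j≡0⇒i*j≡0 (c (punchIn v a) b) (entry-foreign-column θA⁺ θB b p (FinP.punchInᵢ≢i v a))))) ⟨
      Rᵥ (inj₁ (v , p)) + R' (inj₁ (v , p))
        ≡⟨ Rᵥ+R'≡0 (inj₁ (v , p)) ⟩
      0ℤ ∎
    c'≡0 : ∀ a b → c (punchIn v a) b ≡ 0ℤ
    c'≡0 = indep' (λ a b → c (punchIn v a) b) (c-supp ∘ punchIn v) λ col → begin
      sumℤ (λ a → sumℤ (λ b → c (punchIn v a) b * entry θA θB (a , b) col))
        ≡⟨ sumℤ²≡sum² (λ a b → c (punchIn v a) b * entry θA θB (a , b) col) ⟩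
      sum (λ a → sum (λ b → c (punchIn v a) b * entry θA θB (a , b) col))
        ≡⟨ sum-cong-≗ (λ a → sum-cong-≗ (λ b → cong (c (punchIn v a) b *_) (entry-liftCol a b col))) ⟨
      R' (liftCol v col)
        ≡⟨ ℤP.+-identityˡ _ ⟨
      0ℤ + R' (liftCol v col)
        ≡⟨ cong (_+ R' (liftCol v col)) (sum-zero (λ b → j≡0⇒i*j≡0 (c v b) (entry-v-liftCol b col))) ⟨
      Rᵥ (liftCol v col) + R' (liftCol v col)
        ≡⟨ Rᵥ+R'≡0 (liftCol v col) ⟩
      0ℤ ∎

  independent-addVertex : ∀ {r} (f : Fin r → Fin n × Fin m) (g : Fin l → Fin m) →
    Independent (λ i → entry θA θB (f i)) → Independent (λ j p → θB p (g j)) →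
    Independent ((λ i → entry θA⁺ θB (liftEdge v (f i))) ++ (λ j → entry θA⁺ θB (v , g j)))
  independent-addVertex {r} f g indep' indepᵥ c _ comb≡0 = ∀-↑ α≡0 β≡0
    where
    open ≡-Reasoning
    α = c ∘ (_↑ˡ l)
    β = c ∘ (r ↑ʳ_)
    u = λ i → entry θA⁺ θB (liftEdge v (f i))
    w = λ j → entry θA⁺ θB (v , g j)
    α+β≡0 : ∀ col → combination α u col + combination β w col ≡ 0ℤ
    α+β≡0 col = trans (sym (combination-++ c u w col)) (comb≡0 col)
    β≡0 : ∀ j → β j ≡ 0ℤ
    β≡0 = indepᵥ β (λ _ ()) λ p → begin
      sum (λ j → β j * θB p (g j))
        ≡⟨ sum-cong-≗ (λ j → cong (β j *_) (entry-own-column θA⁺ θB v (g j) p)) ⟨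
      combination β w (inj₁ (v , p))
        ≡⟨ ℤP.+-identityˡ _ ⟨
      0ℤ + combination β w (inj₁ (v , p))
        ≡⟨ cong (_+ combination β w (inj₁ (v , p))) (sum-zero (λ i →
             j≡0⇒i*j≡0 (α i) (entry-foreign-column θA⁺ θB _ p (FinP.punchInᵢ≢i v _)))) ⟨
      combination α u (inj₁ (v , p)) + combination β w (inj₁ (v , p))
        ≡⟨ α+β≡0 (inj₁ (v , p)) ⟩
      0ℤ ∎
    α≡0 : ∀ i → α i ≡ 0ℤ
    α≡0 = indep' α (λ _ ()) λ col → begin
      combination α (λ i → entry θA θB (f i)) col
        ≡⟨ sum-cong-≗ (λ i → cong (α i *_) (entry-liftCol _ _ col)) ⟨
      combination α u (liftCol v col)
        ≡⟨ ℤP.+-identityʳ _ ⟨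
      combination α u (liftCol v col) + 0ℤ
        ≡⟨ cong (combination α u (liftCol v col) +_) (sum-zero (λ j → j≡0⇒i*j≡0 (β j) (entry-v-liftCol (g j) col))) ⟨
      combination α u (liftCol v col) + combination β w (liftCol v col)
        ≡⟨ α+β≡0 (liftCol v col) ⟩
      0ℤ ∎

stressFree-addVertex : ∀ {k l n m} (G : BGraph (suc n) m) (v : Fin (suc n)) →
  StressFree k l (deleteA G v) → degA G v ≤ l → StressFree k l G
stressFree-addVertex {k} {l} {n} {m} G v (θA , θB , indep) deg≤l =
  let t , rows-indep , nbrs-indep = point in
  zeroAt v θA , θB[ ℤ.+ t ] ,
  rowsIndependent-addVertex v θA θB[ ℤ.+ t ] G
    (independentOn⇒rowsIndependent θA θB[ ℤ.+ t ] (independentOn-∘ colAt rows-indep)) nbrs-indep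
  where
  Γ = basisOn (G v)
  θB[_] = segment θB Γ
  nbrs : ℤ → Family m (Fin l)
  nbrs t b p = θB[ t ] p b
  point = independent-at-common-point (rowsOnSegment θA θB Γ (remQuot m)) nbrs
    (rowsOnSegment-polynomial θA θB Γ (remQuot m)) (λ b p → segment-polynomial θB Γ p b) 0ℤ 1ℤ
    (independentOn-rowsOnSegment θA θB Γ (remQuot m) (rowsIndependent⇒independentOn θA θB indep))
    (independentOn-cong (λ b p → sym (segment-1 θB Γ p b)) (basisOn-independent (G v) deg≤l))

rankAtLeast-addVertex : ∀ {k l n m r} (G : BGraph (suc n) m) (v : Fin (suc n)) (g : Fin l → Fin m) →
  Injective _≡_ _≡_ g → (∀ j → G v (g j) ≡ true) → RankAtLeast k l (deleteA G v) r → RankAtLeast k l G (r ℕ.+ l)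
rankAtLeast-addVertex {k} {l} {n} {m} {r} G v g g-inj g-adj (θA , θB , f , f-inj , f-edge , indep) =
  let t , rows-indep , nbrs-indep = point in
  zeroAt v θA , θB[ ℤ.+ t ] , F , F-inj , ++-∀ {P = λ e → uncurry G e ≡ true} f-edge g-adj ,
  independent⇒sumℤ-independent (zeroAt v θA) θB[ ℤ.+ t ] F
    (independentOn-cong (λ x col → cong (λ h → h col) (∘-++ (entry (zeroAt v θA) θB[ ℤ.+ t ]) (liftEdge v ∘ f) vg x))
      (independent-addVertex v θA θB[ ℤ.+ t ] f g (independentOn-∘ colAt rows-indep) nbrs-indep))
  where
  Γ = basisAlong g
  θB[_] = segment θB Γ
  vg : Fin l → Fin (suc n) × Fin m
  vg j = v , g j
  F : Fin (r ℕ.+ l) → Fin (suc n) × Fin m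
  F = (liftEdge v ∘ f) ++ vg
  F-inj : Injective _≡_ _≡_ F
  F-inj = ++-injective (λ eq → f-inj (cong₂ _,_ (FinP.punchIn-injective v _ _ (cong proj₁ eq)) (cong proj₂ eq)))
    (g-inj ∘ cong proj₂) (λ i j eq → FinP.punchInᵢ≢i v _ (cong proj₁ eq))
  nbrs : ℤ → Family l (Fin l)
  nbrs t j p = θB[ t ] p (g j)
  point = independent-at-common-point (rowsOnSegment θA θB Γ f) nbrs
    (rowsOnSegment-polynomial θA θB Γ f) (λ j p → segment-polynomial θB Γ p (g j)) 0ℤ 1ℤ
    (independentOn-rowsOnSegment θA θB Γ f (sumℤ-independent⇒independent θA θB f indep))
    (independentOn-cong (λ j p → sym (segment-1 θB Γ p (g j))) (basisAlong-independent g-inj))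

rankAtLeast-bound : ∀ {k l n m r} {G : BGraph n m} (g : Fin l → Fin m) → Injective _≡_ _≡_ g →
  RankAtLeast k l G r → r ℕ.+ k ℕ.* l ≤ l ℕ.* n ℕ.+ k ℕ.* m
rankAtLeast-bound {k} {l} {n} {m} {r} g g-inj (θA , θB , f , _ , _ , indep) =
  let t , rows-indep , motions-indep = point in
  subst (r ℕ.+ k ℕ.* l ≤_) (cong₂ ℕ._+_ (ℕP.*-comm n l) (ℕP.*-comm m k))
    (independent⇒≤ (rowsOnSegment θA θB Γ f (ℤ.+ t) ++ motions (ℤ.+ t))
      (independent-++ rows-indep motions-indep (λ i j → entry⊥trivialMotion θA θB[ ℤ.+ t ] (f i) (remQuot l j))))
  where
  Γ = basisAlong g
  θB[_] = segment θB Γ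
  motions : ℤ → Family (k ℕ.* l) (Fin (n ℕ.* l ℕ.+ m ℕ.* k))
  motions t j x = trivialMotion θA θB[ t ] (remQuot l j) (colAt x)
  point = independent-at-common-point (rowsOnSegment θA θB Γ f) motions
    (rowsOnSegment-polynomial θA θB Γ f)
    (λ j x → trivialMotion-polynomial θA θB[_] (segment-polynomial θB Γ) (remQuot l j) (colAt x)) 0ℤ 1ℤ
    (independentOn-rowsOnSegment θA θB Γ f (sumℤ-independent⇒independent θA θB f indep))
    (independentOn-∘-surjective colAt colAt-surjective
      (independentOn-cong (λ j col → trivialMotion-cong θA (λ p b → sym (segment-1 θB Γ p b)) (remQuot l j) col)
        (trivialMotions-independent g-inj θA)))

rigid-addVertex : ∀ {k l n m} (G : BGraph (suc n) m) (v : Fin (suc n)) →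
  Rigid k l (deleteA G v) → l ≤ degA G v → Rigid k l G
rigid-addVertex {k} {l} {n} {m} G v (r , r+kl≡ , rank≥r , _) l≤deg =
  let g , g-inj , g-adj = pick (G v) l≤deg in
  r ℕ.+ l , count≡ , rankAtLeast-addVertex G v g g-inj g-adj rank≥r ,
  λ rank>r+l → ℕP.<-irrefl count≡ (rankAtLeast-bound {G = G} g g-inj rank>r+l)
  where
  count≡ : r ℕ.+ l ℕ.+ k ℕ.* l ≡ l ℕ.* suc n ℕ.+ k ℕ.* m
  count≡ = begin
    r ℕ.+ l ℕ.+ k ℕ.* l        ≡⟨ swap-l r l (k ℕ.* l) ⟩
    r ℕ.+ k ℕ.* l ℕ.+ l        ≡⟨ cong (ℕ._+ l) r+kl≡ ⟩
    l ℕ.* n ℕ.+ k ℕ.* m ℕ.+ l  ≡⟨ absorb-l l n (k ℕ.* m) ⟩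
    l ℕ.* suc n ℕ.+ k ℕ.* m    ∎
    where
    open ≡-Reasoning
    swap-l : ∀ r l x → r ℕ.+ l ℕ.+ x ≡ r ℕ.+ x ℕ.+ l
    swap-l = NatSolver.solve-∀
    absorb-l : ∀ l n x → l ℕ.* n ℕ.+ x ℕ.+ l ≡ l ℕ.* suc n ℕ.+ x
    absorb-l = NatSolver.solve-∀

transpose : ∀ {n m} → BGraph n m → BGraph m n
transpose G b a = G a b

entry-swap : ∀ {k l n m} (θA : Fin k → Fin n → ℤ) (θB : Fin l → Fin m → ℤ) e col →
  entry θA θB e col ≡ entry θB θA (swap e) (Sum.swap col)
entry-swap θA θB e (inj₁ _) = refl
entry-swap θA θB e (inj₂ _) = refl

stressFree-transpose : ∀ {k l n m} {G : BGraph n m} → StressFree k l G → StressFree l k (transpose G)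
stressFree-transpose (θA , θB , indep) = θB , θA , λ c c-supp stress≡0 b a →
  indep (λ a b → c b a) (λ a b → c-supp b a) (λ col → begin
    sumℤ (λ a → sumℤ (λ b → c b a * entry θA θB (a , b) col))
      ≡⟨ sumℤ²≡sum² (λ a b → c b a * entry θA θB (a , b) col) ⟩
    sum (λ a → sum (λ b → c b a * entry θA θB (a , b) col))
      ≡⟨ ∑-comm (λ a b → c b a * entry θA θB (a , b) col) ⟩
    sum (λ b → sum (λ a → c b a * entry θA θB (a , b) col))
      ≡⟨ sum-cong-≗ (λ b → sum-cong-≗ (λ a → cong (c b a *_) (entry-swap θA θB (a , b) col))) ⟩
    sum (λ b → sum (λ a → c b a * entry θB θA (b , a) (Sum.swap col)))
      ≡⟨ sumℤ²≡sum² (λ b a → c b a * entry θB θA (b , a) (Sum.swap col)) ⟨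
    sumℤ (λ b → sumℤ (λ a → c b a * entry θB θA (b , a) (Sum.swap col)))
      ≡⟨ stress≡0 (Sum.swap col) ⟩
    0ℤ ∎) a b
  where open ≡-Reasoning

rankAtLeast-transpose : ∀ {k l n m r} {G : BGraph n m} → RankAtLeast k l G r → RankAtLeast l k (transpose G) r
rankAtLeast-transpose (θA , θB , f , f-inj , f-edge , indep) =
  θB , θA , swap ∘ f , f-inj ∘ cong swap , f-edge , λ c sums≡0 → indep c (λ col → begin
    sumℤ (λ i → c i * entry θA θB (f i) col)
      ≡⟨ sumℤ≡sum (λ i → c i * entry θA θB (f i) col) ⟩
    sum (λ i → c i * entry θA θB (f i) col)
      ≡⟨ sum-cong-≗ (λ i → cong (c i *_) (entry-swap θA θB (f i) col)) ⟩
    sum (λ i → c i * entry θB θA (swap (f i)) (Sum.swap col))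
      ≡⟨ sumℤ≡sum (λ i → c i * entry θB θA (swap (f i)) (Sum.swap col)) ⟨
    sumℤ (λ i → c i * entry θB θA (swap (f i)) (Sum.swap col))
      ≡⟨ sums≡0 (Sum.swap col) ⟩
    0ℤ ∎)
  where open ≡-Reasoning

rigid-transpose : ∀ {k l n m} {G : BGraph n m} → Rigid k l G → Rigid l k (transpose G)
rigid-transpose {k} {l} {n} {m} {G} (r , r+kl≡ , rank≥r , rank≱r+1) =
  r , trans (cong (r ℕ.+_) (ℕP.*-comm l k)) (trans r+kl≡ (ℕP.+-comm (l ℕ.* n) (k ℕ.* m))) ,
  rankAtLeast-transpose {G = G} rank≥r , rank≱r+1 ∘ rankAtLeast-transpose {G = transpose G}

lemma3p7 : (k l : ℕ) → 1 ≤ k → 1 ≤ l →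
    (∀ {n m} (G : BGraph (suc n) m) (v : Fin (suc n)) →
       StressFree k l (deleteA G v) → degA G v ≤ l → StressFree k l G)
    × (∀ {n m} (G : BGraph n (suc m)) (v : Fin (suc m)) →
       StressFree k l (deleteB G v) → degB G v ≤ k → StressFree k l G)
    × (∀ {n m} (G : BGraph (suc n) m) (v : Fin (suc n)) →
       Rigid k l (deleteA G v) → l ≤ degA G v → Rigid k l G)
    × (∀ {n m} (G : BGraph n (suc m)) (v : Fin (suc m)) →
       Rigid k l (deleteB G v) → k ≤ degB G v → Rigid k l G)
lemma3p7 k l _ _ =
  stressFree-addVertex ,
  (λ G v stressFree deg≤k → stressFree-transpose {G = transpose G}
     (stressFree-addVertex (transpose G) v (stressFree-transpose {G = deleteB G v} stressFree) deg≤k)) ,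
  rigid-addVertex ,
  (λ G v rigid k≤deg → rigid-transpose {G = transpose G}
     (rigid-addVertex (transpose G) v (rigid-transpose {G = deleteB G v} rigid) k≤deg))
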